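{- Let $G$ be a graph and $v$ a vertex of $G$. Then $G$ is a core graph if and only if its Fowler Construction $F(G,v)$ is a core graph. Moreover, $\eta(G)=\eta(F(G,v))$.
   Context: All graphs are finite and simple. For a graph $G$ with 0--1 adjacency matrix $\mathbf{A}(G)$, the nullity $\eta(G)$ is the multiplicity of $0$ as an eigenvalue of $\mathbf{A}(G)$. A vertex is a core vertex if it corresponds to a nonzero entry of some vector in $\ker \mathbf{A}(G)$; a core graph is a singular graph all of whose vertices are core vertices. Fowler Construction: let $v$ have degree $\rho$ with neighbours $u_1,\dots,u_\rho$. The graph $F(G,v)$ is obtained from $G$ by adding $2\rho$ new vertices $p_1,\dots,p_\rho,q_1,\dots,q_\rho$; for each $i$, deleting the edge $vu_i$ and adding edges $vq_i$ and $p_iu_i$; and finally adding the edges $p_iq_j$ for all $i,j\in\{1,\dots,\rho\}$ with $i\neq j$. -}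

module Defs where

open import Data.Nat using (ℕ; zero; suc; _+_; _≤_)
open import Data.Fin using (Fin; splitAt)
import Data.Fin as Fin
open import Data.Empty using (⊥-elim)
open import Data.Fin.Properties using (_≟_)
open import Data.Bool using (Bool; true; false; _∧_; not)
open import Data.Bool.Properties using (∧-comm)
open import Data.Sum using (_⊎_; inj₁; inj₂)
open import Data.Product using (Σ; _×_; _,_)
open import Data.List using (List; length; lookup; filterᵇ; allFin)
open import Data.Rational using (ℚ; 0ℚ; 1ℚ) renaming (_*_ to _*ℚ_; _+_ to _+ℚ_)
open import Relation.Nullary using (¬_; yes; no)
open import Relation.Nullary.Decidable using (⌊_⌋)
open import Relation.Binary.PropositionalEquality using (_≡_; _≢_; refl; sym; cong; cong₂)

record Graph (n : ℕ) : Set where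
  field
    adj    : Fin n → Fin n → Bool
    adj-sym    : ∀ i j → adj i j ≡ adj j i
    adj-irrefl : ∀ i → adj i i ≡ false
open Graph public

Σ[<] : (n : ℕ) → (Fin n → ℚ) → ℚ
Σ[<] zero    f = 0ℚ
Σ[<] (suc n) f = f Fin.zero +ℚ Σ[<] n (λ i → f (Fin.suc i))

A : ∀ {n} → Graph n → Fin n → Fin n → ℚ
A G i j with adj G i j
... | true  = 1ℚ
... | false = 0ℚ

InKer : ∀ {n} → Graph n → (Fin n → ℚ) → Set
InKer {n} G x = ∀ i → Σ[<] n (λ j → A G i j *ℚ x j) ≡ 0ℚ

LinIndep : ∀ {n k} → (Fin k → Fin n → ℚ) → Set
LinIndep {n} {k} xs =
  (c : Fin k → ℚ) → (∀ i → Σ[<] k (λ l → c l *ℚ xs l i) ≡ 0ℚ) → ∀ l → c l ≡ 0ℚ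

-- η(G) = k : k is the dimension of ker A(G), i.e. the maximum size of a
-- linearly independent family of kernel vectors
-- (= multiplicity of eigenvalue 0, A(G) being symmetric)
HasNullity : ∀ {n} → Graph n → ℕ → Set
HasNullity {n} G k =
  (Σ (Fin k → Fin n → ℚ) λ xs → (∀ l → InKer G (xs l)) × LinIndep xs)
  × (∀ m (xs : Fin m → Fin n → ℚ) → (∀ l → InKer G (xs l)) → LinIndep xs → m ≤ k)

CoreVertex : ∀ {n} → Graph n → Fin n → Set
CoreVertex {n} G v = Σ (Fin n → ℚ) λ x → InKer G x × x v ≢ 0ℚ

Singular : ∀ {n} → Graph n → Set
Singular {n} G = Σ (Fin n → ℚ) λ x → InKer G x × Σ (Fin n) λ i → x i ≢ 0ℚ

IsCoreGraph : ∀ {n} → Graph n → Set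
IsCoreGraph {n} G = Singular G × (∀ u → CoreVertex G u)

_==_ : ∀ {n} → Fin n → Fin n → Bool
i == j = ⌊ i ≟ j ⌋

==-sym : ∀ {n} (i j : Fin n) → (i == j) ≡ (j == i)
==-sym i j with i ≟ j | j ≟ i
... | yes _ | yes _ = refl
... | no _  | no _  = refl
... | yes p | no q  = ⊥-elim (q (sym p))
... | no p  | yes q = ⊥-elim (p (sym q))

==-refl : ∀ {n} (i : Fin n) → (i == i) ≡ true
==-refl i with i ≟ i
... | yes _ = refl
... | no p  = ⊥-elim (p refl)

nbrs : ∀ {n} → Graph n → Fin n → List (Fin n)
nbrs {n} G v = filterᵇ (adj G v) (allFin n)

deg : ∀ {n} → Graph n → Fin n → ℕ
deg G v = length (nbrs G v)

nbr : ∀ {n} (G : Graph n) (v : Fin n) → Fin (deg G v) → Fin n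
nbr G v i = lookup (nbrs G v) i

-- vertices of F(G,v): old vertices ⊎ (p₁..p_ρ ⊎ q₁..q_ρ)
module _ {n : ℕ} (G : Graph n) (v : Fin n) where
  private
    ρ = deg G v
    u = nbr G v

  FV : Set
  FV = Fin n ⊎ (Fin ρ ⊎ Fin ρ)

  fadj : FV → FV → Bool
  fadj (inj₁ x) (inj₁ y) = adj G x y ∧ not (x == v) ∧ not (y == v)
  fadj (inj₁ x) (inj₂ (inj₁ i)) = x == u i
  fadj (inj₁ x) (inj₂ (inj₂ j)) = x == v
  fadj (inj₂ (inj₁ i)) (inj₁ y) = y == u i
  fadj (inj₂ (inj₂ j)) (inj₁ y) = y == v
  fadj (inj₂ (inj₁ i)) (inj₂ (inj₁ j)) = false
  fadj (inj₂ (inj₂ i)) (inj₂ (inj₂ j)) = false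
  fadj (inj₂ (inj₁ i)) (inj₂ (inj₂ j)) = not (i == j)
  fadj (inj₂ (inj₂ j)) (inj₂ (inj₁ i)) = not (i == j)

  fadj-sym : ∀ a b → fadj a b ≡ fadj b a
  fadj-sym (inj₁ x) (inj₁ y) =
    cong₂ _∧_ (adj-sym G x y) (∧-comm (not (x == v)) (not (y == v)))
  fadj-sym (inj₁ x) (inj₂ (inj₁ i)) = refl
  fadj-sym (inj₁ x) (inj₂ (inj₂ j)) = refl
  fadj-sym (inj₂ (inj₁ i)) (inj₁ y) = refl
  fadj-sym (inj₂ (inj₂ j)) (inj₁ y) = refl
  fadj-sym (inj₂ (inj₁ i)) (inj₂ (inj₁ j)) = refl
  fadj-sym (inj₂ (inj₂ i)) (inj₂ (inj₂ j)) = refl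
  fadj-sym (inj₂ (inj₁ i)) (inj₂ (inj₂ j)) = refl
  fadj-sym (inj₂ (inj₂ j)) (inj₂ (inj₁ i)) = refl

  fadj-irrefl : ∀ a → fadj a a ≡ false
  fadj-irrefl (inj₁ x) = cong (_∧ (not (x == v) ∧ not (x == v))) (adj-irrefl G x)
  fadj-irrefl (inj₂ (inj₁ i)) = refl
  fadj-irrefl (inj₂ (inj₂ i)) = refl

  -- F(G,v) on vertex set Fin (n + (ρ + ρ)):
  -- first n = old vertices, next ρ = p₁..p_ρ, last ρ = q₁..q_ρ
  split : Fin (n + (ρ + ρ)) → FV
  split a with splitAt n a
  ... | inj₁ x = inj₁ x
  ... | inj₂ b = inj₂ (splitAt ρ b)

  Fowler : Graph (n + (deg G v + deg G v))
  Fowler = record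
    { adj    = λ a b → fadj (split a) (split b)
    ; adj-sym    = λ a b → fadj-sym (split a) (split b)
    ; adj-irrefl = λ a → fadj-irrefl (split a)
    }

module Submission where

-- Both claims follow from an explicit linear isomorphism
-- ker A(G) ≅ ker A(F(G,v)).  With ρ = deg v and neighbours u₁,…,u_ρ, a kernel
-- vector y of G expands to the vector of F(G,v) that agrees with y on the old
-- vertices w ≠ v, is (1 - ρ)·y(v) at v, y(v) at every pᵢ and y(uᵢ) at every
-- qᵢ; a kernel vector z of F(G,v) contracts to z on the old vertices plus
-- Σᵢ z(pᵢ) at v.  Reading off the four kinds of rows of A(F(G,v)) shows that
-- both maps preserve kernels and are mutually inverse there.
--
-- Kernel isomorphisms then transfer nullity, singularity and,
-- vertex by vertex, core vertices whenever an entry of the image is a fixed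
-- multiple of an entry of the source.  Finally the rows of A(F(G,v)) are
-- computed, the isomorphism is built, and the weight 1 - ρ at v is handled:
-- it vanishes only when v is a leaf, and then G is not a core graph.

open import Defs
open import Data.Nat using (ℕ)
open import Data.Fin using (Fin)
open import Data.Product using (Σ; _×_)
open import Function.Bundles using (_⇔_)

open import Algebra.Bundles using (CommutativeRing)
import Algebra.Properties.CommutativeMonoid.Sum as CommutativeMonoidSum
import Algebra.Properties.Semiring.Sum as SemiringSum
open import Data.Bool using (Bool; true; false; _∧_; not)
open import Data.Bool.Properties using (∧-zeroʳ)
open import Data.Empty using (⊥-elim)
open import Data.Fin as Fin using (zero; suc; punchIn; splitAt; join; _↑ˡ_; _↑ʳ_)
import Data.Fin.Properties as FinP
open import Data.List using (List; []; _∷_; length; lookup; filterᵇ; allFin; tabulate)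
open import Data.Maybe using (Maybe; just; nothing)
open import Data.Nat as ℕ using (zero; suc; z≤n; s≤s)
import Data.Nat.Properties as ℕP
open import Data.Product using (_,_; proj₁; proj₂)
import Data.Rational as ℚ
open import Data.Rational using (ℚ; 0ℚ; 1ℚ; _+_; _*_; -_; _-_; 1/_; NonZero; ≢-nonZero)
import Data.Rational.Properties as ℚP
open import Data.Sum using (_⊎_; inj₁; inj₂)
open import Data.Vec.Functional using (insertAt)
open import Data.Vec.Functional.Properties using (insertAt-lookup; insertAt-punchIn; insertAt-removeAt)
open import Function using (_∘_)
open import Function.Bundles using (mk⇔)
open import Relation.Binary.PropositionalEquality
open import Relation.Nullary using (¬_; yes; no; Dec)
open import Tactic.RingSolver using (solve-∀)
open import Tactic.RingSolver.Core.AlmostCommutativeRing using (AlmostCommutativeRing; fromCommutativeRing)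

ℚ-ring : AlmostCommutativeRing _ _
ℚ-ring = fromCommutativeRing ℚP.+-*-commutativeRing isZero
  where
  isZero : ∀ x → Maybe (0ℚ ≡ x)
  isZero x with 0ℚ ℚP.≟ x
  ... | yes 0≡x = just 0≡x
  ... | no _    = nothing

δ : Bool → ℚ
δ true  = 1ℚ
δ false = 0ℚ

weight-zero : ∀ {b} → b ≡ false → ∀ y → δ b * y ≡ 0ℚ
weight-zero refl = ℚP.*-zeroˡ

weight-one : ∀ {b} → b ≡ true → ∀ y → δ b * y ≡ y
weight-one refl = ℚP.*-identityˡ

fromℕ : ℕ → ℚ
fromℕ zero    = 0ℚ
fromℕ (suc n) = 1ℚ + fromℕ n

fromℕ-nonNegative : ∀ m → 0ℚ ℚ.≤ fromℕ m
fromℕ-nonNegative zero    = ℚP.≤-refl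
fromℕ-nonNegative (suc m) =
  subst (ℚ._≤ fromℕ (suc m)) (ℚP.+-identityˡ 0ℚ)
        (ℚP.+-mono-≤ (ℚP.nonNegative⁻¹ 1ℚ) (fromℕ-nonNegative m))

1-fromℕ≢0 : ∀ m → m ≢ 1 → 1ℚ - fromℕ m ≢ 0ℚ
1-fromℕ≢0 zero          _   1-0≡0 = ℚP.1≢0 (trans (sym (ℚP.+-identityʳ 1ℚ)) 1-0≡0)
1-fromℕ≢0 (suc zero)    m≢1 _     = m≢1 refl
1-fromℕ≢0 (suc (suc m)) _   1-m≡0 = ℚP.<-irrefl refl (ℚP.<-≤-trans (ℚP.positive⁻¹ 1ℚ) 1≤0)
  where
  negate : ∀ x → - (1ℚ - (1ℚ + (1ℚ + x))) ≡ 1ℚ + x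
  negate = solve-∀ ℚ-ring
  1≤0 : 1ℚ ℚ.≤ 0ℚ
  1≤0 = subst (1ℚ ℚ.≤_) (trans (sym (negate (fromℕ m))) (cong -_ 1-m≡0))
              (subst (ℚ._≤ 1ℚ + fromℕ m) (ℚP.+-identityʳ 1ℚ) (ℚP.+-monoʳ-≤ 1ℚ (fromℕ-nonNegative m)))

*-≢0 : ∀ a b → a ≢ 0ℚ → b ≢ 0ℚ → a * b ≢ 0ℚ
*-≢0 a b a≢0 b≢0 a*b≡0 = b≢0 (begin
  b               ≡⟨ sym (ℚP.*-identityˡ b) ⟩
  1ℚ * b          ≡⟨ cong (_* b) (sym (ℚP.*-inverseˡ a)) ⟩
  1/ a * a * b    ≡⟨ ℚP.*-assoc (1/ a) a b ⟩
  1/ a * (a * b)  ≡⟨ cong (1/ a *_) a*b≡0 ⟩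
  1/ a * 0ℚ       ≡⟨ ℚP.*-zeroʳ (1/ a) ⟩
  0ℚ              ∎)
  where
  open ≡-Reasoning
  instance
    a-nonZero : NonZero a
    a-nonZero = ≢-nonZero a≢0

module Sums where
  open CommutativeMonoidSum ℚP.+-0-commutativeMonoid using (sum; ∑-distrib-+; ∑-comm; sum-remove)
  open SemiringSum (CommutativeRing.semiring ℚP.+-*-commutativeRing) using (*-distribˡ-sum)

  Σ≡sum : ∀ n (f : Fin n → ℚ) → Σ[<] n f ≡ sum f
  Σ≡sum zero    f = refl
  Σ≡sum (suc n) f = cong (f zero +_) (Σ≡sum n (f ∘ suc))

  Σ-cong : ∀ {n} {f g : Fin n → ℚ} → (∀ i → f i ≡ g i) → Σ[<] n f ≡ Σ[<] n g
  Σ-cong {zero}  h = refl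
  Σ-cong {suc n} h = cong₂ _+_ (h zero) (Σ-cong (h ∘ suc))

  Σ-zero : ∀ {n} {f : Fin n → ℚ} → (∀ i → f i ≡ 0ℚ) → Σ[<] n f ≡ 0ℚ
  Σ-zero {zero}  h = refl
  Σ-zero {suc n} h = cong₂ _+_ (h zero) (Σ-zero (h ∘ suc))

  single-term : ∀ {m} (m≡1 : m ≡ 1) (f : Fin m → ℚ) → Σ[<] m f ≡ 0ℚ → f (subst Fin (sym m≡1) zero) ≡ 0ℚ
  single-term refl f f₀+0≡0 = trans (sym (ℚP.+-identityʳ (f zero))) f₀+0≡0

  Σ-+ : ∀ {n} (f g : Fin n → ℚ) → Σ[<] n (λ i → f i + g i) ≡ Σ[<] n f + Σ[<] n g
  Σ-+ {n} f g = begin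
    Σ[<] n (λ i → f i + g i)  ≡⟨ Σ≡sum n _ ⟩
    sum (λ i → f i + g i)     ≡⟨ ∑-distrib-+ f g ⟩
    sum f + sum g             ≡⟨ sym (cong₂ _+_ (Σ≡sum n f) (Σ≡sum n g)) ⟩
    Σ[<] n f + Σ[<] n g       ∎
    where open ≡-Reasoning

  Σ-*ˡ : ∀ {n} c (f : Fin n → ℚ) → Σ[<] n (λ i → c * f i) ≡ c * Σ[<] n f
  Σ-*ˡ {n} c f = begin
    Σ[<] n (λ i → c * f i)  ≡⟨ Σ≡sum n _ ⟩
    sum (λ i → c * f i)     ≡⟨ sym (*-distribˡ-sum c f) ⟩
    c * sum f               ≡⟨ cong (c *_) (sym (Σ≡sum n f)) ⟩
    c * Σ[<] n f            ∎
    where open ≡-Reasoning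

  Σ-*ʳ : ∀ {n} c (f : Fin n → ℚ) → Σ[<] n (λ i → f i * c) ≡ Σ[<] n f * c
  Σ-*ʳ c f = trans (Σ-cong (λ i → ℚP.*-comm (f i) c))
                   (trans (Σ-*ˡ c f) (ℚP.*-comm c _))

  Σ-- : ∀ {n} (f g : Fin n → ℚ) → Σ[<] n (λ i → f i - g i) ≡ Σ[<] n f - Σ[<] n g
  Σ-- {n} f g = begin
    Σ[<] n (λ i → f i - g i)                ≡⟨ Σ-cong (λ i → minus-as-scaling (f i) (g i)) ⟩
    Σ[<] n (λ i → f i + (- 1ℚ) * g i)       ≡⟨ Σ-+ f (λ i → (- 1ℚ) * g i) ⟩
    Σ[<] n f + Σ[<] n (λ i → (- 1ℚ) * g i)  ≡⟨ cong (Σ[<] n f +_) (Σ-*ˡ (- 1ℚ) g) ⟩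
    Σ[<] n f + (- 1ℚ) * Σ[<] n g            ≡⟨ sym (minus-as-scaling (Σ[<] n f) (Σ[<] n g)) ⟩
    Σ[<] n f - Σ[<] n g                     ∎
    where
    open ≡-Reasoning
    minus-as-scaling : ∀ a b → a - b ≡ a + (- 1ℚ) * b
    minus-as-scaling = solve-∀ ℚ-ring

  Σ-swap : ∀ {m n} (h : Fin m → Fin n → ℚ) →
    Σ[<] m (λ i → Σ[<] n (h i)) ≡ Σ[<] n (λ j → Σ[<] m (λ i → h i j))
  Σ-swap {m} {n} h = begin
    Σ[<] m (λ i → Σ[<] n (h i))            ≡⟨ trans (Σ-cong (λ i → Σ≡sum n (h i))) (Σ≡sum m _) ⟩
    sum (λ i → sum (h i))                  ≡⟨ ∑-comm h ⟩
    sum (λ j → sum (λ i → h i j))          ≡⟨ sym (trans (Σ-cong (λ j → Σ≡sum m (λ i → h i j))) (Σ≡sum n _)) ⟩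
    Σ[<] n (λ j → Σ[<] m (λ i → h i j))    ∎
    where open ≡-Reasoning

  Σ-punch : ∀ {m} (j : Fin (suc m)) (f : Fin (suc m) → ℚ) →
    Σ[<] (suc m) f ≡ f j + Σ[<] m (f ∘ punchIn j)
  Σ-punch {m} j f = begin
    Σ[<] (suc m) f               ≡⟨ Σ≡sum (suc m) f ⟩
    sum f                        ≡⟨ sum-remove f ⟩
    f j + sum (f ∘ punchIn j)    ≡⟨ cong (f j +_) (sym (Σ≡sum m _)) ⟩
    f j + Σ[<] m (f ∘ punchIn j) ∎
    where open ≡-Reasoning

  Σ-const : ∀ n c → Σ[<] n (λ _ → c) ≡ fromℕ n * c
  Σ-const zero    c = sym (ℚP.*-zeroˡ c)
  Σ-const (suc n) c = trans (cong (c +_) (Σ-const n c)) (lemma c (fromℕ n))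
    where
    lemma : ∀ c x → c + x * c ≡ (1ℚ + x) * c
    lemma = solve-∀ ℚ-ring

  Σ-++ : ∀ n m (f : Fin (n ℕ.+ m) → ℚ) →
    Σ[<] (n ℕ.+ m) f ≡ Σ[<] n (λ i → f (i ↑ˡ m)) + Σ[<] m (λ j → f (n ↑ʳ j))
  Σ-++ zero    m f = sym (ℚP.+-identityˡ _)
  Σ-++ (suc n) m f =
    trans (cong (f zero +_) (Σ-++ n m (f ∘ suc))) (sym (ℚP.+-assoc (f zero) _ _))

  ==-false : ∀ {n} {i j : Fin n} → i ≢ j → (i == j) ≡ false
  ==-false {i = i} {j} i≢j with i FinP.≟ j
  ... | yes i≡j = ⊥-elim (i≢j i≡j)
  ... | no _    = refl

  Σ-δ : ∀ {n} (c : Fin n) (f : Fin n → ℚ) → Σ[<] n (λ j → δ (j == c) * f j) ≡ f c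
  Σ-δ {suc n} c f = begin
    Σ[<] (suc n) (λ j → δ (j == c) * f j)
      ≡⟨ Σ-punch c (λ j → δ (j == c) * f j) ⟩
    δ (c == c) * f c + Σ[<] n (λ j → δ (punchIn c j == c) * f (punchIn c j))
      ≡⟨ cong₂ _+_ (cong (λ b → δ b * f c) (==-refl c)) (Σ-zero off-diagonal) ⟩
    1ℚ * f c + 0ℚ
      ≡⟨ unit (f c) ⟩
    f c ∎
    where
    open ≡-Reasoning
    unit : ∀ x → 1ℚ * x + 0ℚ ≡ x
    unit = solve-∀ ℚ-ring
    off-diagonal : ∀ j → δ (punchIn c j == c) * f (punchIn c j) ≡ 0ℚ
    off-diagonal j = trans (cong (λ b → δ b * f (punchIn c j)) (==-false (FinP.punchInᵢ≢i c j)))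
                           (ℚP.*-zeroˡ (f (punchIn c j)))

  Σ-δ' : ∀ {n} (c : Fin n) (f : Fin n → ℚ) → Σ[<] n (λ j → δ (c == j) * f j) ≡ f c
  Σ-δ' c f = trans (Σ-cong (λ j → cong (λ b → δ b * f j) (==-sym c j))) (Σ-δ c f)

  Σ-all-but : ∀ {n} (c : Fin n) (f : Fin n → ℚ) →
    Σ[<] n (λ j → δ (not (j == c)) * f j) ≡ Σ[<] n f - f c
  Σ-all-but {n} c f = begin
    Σ[<] n (λ j → δ (not (j == c)) * f j)              ≡⟨ Σ-cong (λ j → δ-not (j == c) (f j)) ⟩
    Σ[<] n (λ j → f j - δ (j == c) * f j)              ≡⟨ Σ-- f (λ j → δ (j == c) * f j) ⟩
    Σ[<] n f - Σ[<] n (λ j → δ (j == c) * f j)         ≡⟨ cong (λ z → Σ[<] n f - z) (Σ-δ c f) ⟩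
    Σ[<] n f - f c                                     ∎
    where
    open ≡-Reasoning
    δ-not : ∀ b y → δ (not b) * y ≡ y - δ b * y
    δ-not true  = solve-∀ ℚ-ring
    δ-not false = solve-∀ ℚ-ring

open Sums

module LinearAlgebra where

  combination : ∀ {n k} → (Fin k → ℚ) → (Fin k → Fin n → ℚ) → Fin n → ℚ
  combination {k = k} c B i = Σ[<] k (λ l → c l * B l i)

  zero-or-nonzero : ∀ {m} (f : Fin m → ℚ) → (∀ j → f j ≡ 0ℚ) ⊎ Σ (Fin m) λ j → f j ≢ 0ℚ
  zero-or-nonzero {m} f with FinP.all? (λ j → f j ℚP.≟ 0ℚ)
  ... | yes all-zero = inj₁ all-zero
  ... | no ¬all-zero = inj₂ (FinP.¬∀⟶∃¬ m _ (λ j → f j ℚP.≟ 0ℚ) ¬all-zero)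

  eliminate : ∀ {m N} → (Fin (suc m) → Fin N → ℚ) → Fin (suc m) → (Fin m → ℚ) → Fin m → Fin N → ℚ
  eliminate w j₀ t j i = w (punchIn j₀ j) i - t j * w j₀ i

  combination-eliminate : ∀ {m N} (w : Fin (suc m) → Fin N → ℚ) j₀ (t α : Fin m → ℚ) i →
    combination (insertAt α j₀ (- Σ[<] m (λ j → α j * t j))) w i
      ≡ combination α (eliminate w j₀ t) i
  combination-eliminate {m} w j₀ t α i = begin
    Σ[<] (suc m) (λ l → β l * w l i)
      ≡⟨ Σ-punch j₀ (λ l → β l * w l i) ⟩
    β j₀ * w j₀ i + Σ[<] m (λ j → β (punchIn j₀ j) * w (punchIn j₀ j) i)
      ≡⟨ cong₂ _+_ (cong (_* w j₀ i) (insertAt-lookup α j₀ _))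
                   (Σ-cong (λ j → cong (_* w (punchIn j₀ j) i) (insertAt-punchIn α j₀ _ j))) ⟩
    (- S) * w j₀ i + X
      ≡⟨ move-left S (w j₀ i) X ⟩
    X - S * w j₀ i
      ≡⟨ cong (λ z → X - z) (sym (Σ-*ʳ (w j₀ i) (λ j → α j * t j))) ⟩
    X - Σ[<] m (λ j → α j * t j * w j₀ i)
      ≡⟨ sym (Σ-- (λ j → α j * w (punchIn j₀ j) i) (λ j → α j * t j * w j₀ i)) ⟩
    Σ[<] m (λ j → α j * w (punchIn j₀ j) i - α j * t j * w j₀ i)
      ≡⟨ Σ-cong (λ j → factor (α j) (w (punchIn j₀ j) i) (t j) (w j₀ i)) ⟩
    Σ[<] m (λ j → α j * (w (punchIn j₀ j) i - t j * w j₀ i)) ∎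
    where
    open ≡-Reasoning
    S : ℚ
    S = Σ[<] m (λ j → α j * t j)
    X : ℚ
    X = Σ[<] m (λ j → α j * w (punchIn j₀ j) i)
    β : Fin (suc m) → ℚ
    β = insertAt α j₀ (- S)
    move-left : ∀ s y x → (- s) * y + x ≡ x - s * y
    move-left = solve-∀ ℚ-ring
    factor : ∀ a x τ y → a * x - a * τ * y ≡ a * (x - τ * y)
    factor = solve-∀ ℚ-ring

  eliminate-indep : ∀ {m N} (w : Fin (suc m) → Fin N → ℚ) j₀ (t : Fin m → ℚ) →
    LinIndep w → LinIndep (eliminate w j₀ t)
  eliminate-indep {m} w j₀ t w-indep α vanishes j = begin
    α j                  ≡⟨ sym (insertAt-punchIn α j₀ _ j) ⟩
    β (punchIn j₀ j)     ≡⟨ w-indep β (λ i → trans (combination-eliminate w j₀ t α i) (vanishes i)) (punchIn j₀ j) ⟩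
    0ℚ                   ∎
    where
    open ≡-Reasoning
    β : Fin (suc m) → ℚ
    β = insertAt α j₀ (- Σ[<] m (λ j → α j * t j))

  drop-zero-coordinate : ∀ {m k} (w : Fin m → Fin (suc k) → ℚ) → (∀ j → w j zero ≡ 0ℚ) →
    LinIndep w → LinIndep (λ j i → w j (suc i))
  drop-zero-coordinate w zero-coordinate w-indep c vanishes = w-indep c λ
    { zero    → Σ-zero (λ l → trans (cong (c l *_) (zero-coordinate l)) (ℚP.*-zeroʳ (c l)))
    ; (suc i) → vanishes i }

  clear-pivot : ∀ a d .{{_ : NonZero d}} → a - (a * 1/ d) * d ≡ 0ℚ
  clear-pivot a d = begin
    a - (a * 1/ d) * d  ≡⟨ cong (λ z → a - z) (ℚP.*-assoc a (1/ d) d) ⟩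
    a - a * (1/ d * d)  ≡⟨ cong (λ z → a - a * z) (ℚP.*-inverseˡ d) ⟩
    a - a * 1ℚ          ≡⟨ cong (λ z → a - z) (ℚP.*-identityʳ a) ⟩
    a - a               ≡⟨ ℚP.+-inverseʳ a ⟩
    0ℚ                  ∎
    where open ≡-Reasoning

  steinitz : ∀ k m (w : Fin m → Fin k → ℚ) → LinIndep w → m ℕ.≤ k
  steinitz zero zero    w w-indep = z≤n
  steinitz zero (suc m) w w-indep with w-indep (λ _ → 1ℚ) (λ ()) zero
  ... | ()
  steinitz (suc k) m w w-indep with zero-or-nonzero (λ j → w j zero)
  ... | inj₁ zero-column =
    ℕP.m≤n⇒m≤1+n (steinitz k m _ (drop-zero-coordinate w zero-column w-indep))
  steinitz (suc k) (suc m) w w-indep | inj₂ (j₀ , pivot≢0) =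
    s≤s (steinitz k m _ (drop-zero-coordinate w′ cleared (eliminate-indep w j₀ t w-indep)))
    where
    d : ℚ
    d = w j₀ zero
    instance
      d-nonZero : NonZero d
      d-nonZero = ≢-nonZero pivot≢0
    t : Fin m → ℚ
    t j = w (punchIn j₀ j) zero * 1/ d
    w′ : Fin m → Fin (suc k) → ℚ
    w′ = eliminate w j₀ t
    cleared : ∀ j → w′ j zero ≡ 0ℚ
    cleared j = clear-pivot (w (punchIn j₀ j) zero) d

  dot : ∀ {n} → (Fin n → ℚ) → (Fin n → ℚ) → ℚ
  dot {n} a x = Σ[<] n (λ j → a j * x j)

  Ker : ∀ {r n} → (Fin r → Fin n → ℚ) → (Fin n → ℚ) → Set
  Ker R x = ∀ i → dot (R i) x ≡ 0ℚ

  record Basis {r n} (R : Fin r → Fin n → ℚ) (k : ℕ) : Set where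
    field
      vec   : Fin k → Fin n → ℚ
      mem   : ∀ l → Ker R (vec l)
      indep : LinIndep vec
      span  : ∀ x → Ker R x → Σ (Fin k → ℚ) λ c → ∀ i → x i ≡ combination c vec i

  dot-cong : ∀ {n} (a : Fin n → ℚ) {x y : Fin n → ℚ} → (∀ j → x j ≡ y j) → dot a x ≡ dot a y
  dot-cong a x≗y = Σ-cong (λ j → cong (a j *_) (x≗y j))

  dot-combination : ∀ {n k} (a : Fin n → ℚ) (c : Fin k → ℚ) (B : Fin k → Fin n → ℚ) →
    dot a (combination c B) ≡ Σ[<] k (λ l → c l * dot a (B l))
  dot-combination {n} {k} a c B = begin
    Σ[<] n (λ j → a j * Σ[<] k (λ l → c l * B l j))
      ≡⟨ Σ-cong (λ j → sym (Σ-*ˡ (a j) (λ l → c l * B l j))) ⟩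
    Σ[<] n (λ j → Σ[<] k (λ l → a j * (c l * B l j)))
      ≡⟨ Σ-swap (λ j l → a j * (c l * B l j)) ⟩
    Σ[<] k (λ l → Σ[<] n (λ j → a j * (c l * B l j)))
      ≡⟨ Σ-cong (λ l → trans (Σ-cong (λ j → swap-scalar (a j) (c l) (B l j)))
                             (Σ-*ˡ (c l) (λ j → a j * B l j))) ⟩
    Σ[<] k (λ l → c l * dot a (B l)) ∎
    where
    open ≡-Reasoning
    swap-scalar : ∀ a c b → a * (c * b) ≡ c * (a * b)
    swap-scalar = solve-∀ ℚ-ring

  dot-eliminate : ∀ {n} (a x y : Fin n → ℚ) t → dot a (λ i → x i - t * y i) ≡ dot a x - t * dot a y
  dot-eliminate a x y t =
    trans (Σ-cong (λ j → distribute (a j) (x j) t (y j)))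
    (trans (Σ-- (λ j → a j * x j) (λ j → t * (a j * y j)))
           (cong (λ z → dot a x - z) (Σ-*ˡ t (λ j → a j * y j))))
    where
    distribute : ∀ a x t y → a * (x - t * y) ≡ a * x - t * (a * y)
    distribute = solve-∀ ℚ-ring

  standard-basis : ∀ {n} (R : Fin zero → Fin n → ℚ) → Basis R n
  standard-basis {n} R = record
    { vec   = e
    ; mem   = λ l ()
    ; indep = λ c vanishes l → trans (sym (coordinates c l)) (vanishes l)
    ; span  = λ x _ → x , (λ i → sym (coordinates x i))
    }
    where
    e : Fin n → Fin n → ℚ
    e l i = δ (l == i)
    coordinates : ∀ x i → combination x e i ≡ x i
    coordinates x i = trans (Σ-cong (λ l → ℚP.*-comm (x l) (δ (l == i)))) (Σ-δ i x)

  -- Adding a row R₀ to a matrix: if R₀ is not orthogonal to the basis vector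
  -- at j₀, eliminating against that vector yields a basis one smaller.
  module AddPivotRow {n r k} (R : Fin (suc r) → Fin n → ℚ)
                     (b : Basis (R ∘ suc) (suc k)) (j₀ : Fin (suc k))
                     (pivot≢0 : dot (R zero) (Basis.vec b j₀) ≢ 0ℚ) where
    open Basis b
    d : Fin (suc k) → ℚ
    d l = dot (R zero) (vec l)
    instance
      d-nonZero : NonZero (d j₀)
      d-nonZero = ≢-nonZero pivot≢0
    t : Fin k → ℚ
    t j = d (punchIn j₀ j) * 1/ (d j₀)

    vec′ : Fin k → Fin n → ℚ
    vec′ = eliminate vec j₀ t

    mem′ : ∀ j → Ker R (vec′ j)
    mem′ j zero = trans (dot-eliminate (R zero) (vec (punchIn j₀ j)) (vec j₀) (t j))
                        (clear-pivot (d (punchIn j₀ j)) (d j₀))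
    mem′ j (suc i) = begin
      dot (R (suc i)) (vec′ j)
        ≡⟨ dot-eliminate (R (suc i)) (vec (punchIn j₀ j)) (vec j₀) (t j) ⟩
      dot (R (suc i)) (vec (punchIn j₀ j)) - t j * dot (R (suc i)) (vec j₀)
        ≡⟨ cong₂ (λ a b → a - t j * b) (mem (punchIn j₀ j) i) (mem j₀ i) ⟩
      0ℚ - t j * 0ℚ
        ≡⟨ cong (λ z → 0ℚ - z) (ℚP.*-zeroʳ (t j)) ⟩
      0ℚ ∎
      where open ≡-Reasoning

    -- If x = Σ γₗ vecₗ is also orthogonal to R₀, the pivot coefficient is
    -- determined by the others, so x is a combination of the vec′ⱼ.
    span′ : ∀ x → Ker R x → Σ (Fin k → ℚ) λ c → ∀ i → x i ≡ combination c vec′ i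
    span′ x x∈ker = α , x-expansion
      where
      γ : Fin (suc k) → ℚ
      γ = proj₁ (span x (x∈ker ∘ suc))
      α : Fin k → ℚ
      α = γ ∘ punchIn j₀
      T : ℚ
      T = Σ[<] k (λ j → α j * d (punchIn j₀ j))
      orthogonal : γ j₀ * d j₀ + T ≡ 0ℚ
      orthogonal = begin
        γ j₀ * d j₀ + T                   ≡⟨ sym (Σ-punch j₀ (λ l → γ l * d l)) ⟩
        Σ[<] (suc k) (λ l → γ l * d l)    ≡⟨ sym (dot-combination (R zero) γ vec) ⟩
        dot (R zero) (combination γ vec)  ≡⟨ sym (dot-cong (R zero) (proj₂ (span x (x∈ker ∘ suc)))) ⟩
        dot (R zero) x                    ≡⟨ x∈ker zero ⟩
        0ℚ                                ∎
        where open ≡-Reasoning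
      pivot-coefficient : - Σ[<] k (λ j → α j * t j) ≡ γ j₀
      pivot-coefficient = begin
        - Σ[<] k (λ j → α j * t j)      ≡⟨ cong -_ (Σ-cong (λ j → sym (ℚP.*-assoc (α j) _ _))) ⟩
        - Σ[<] k (λ j → α j * d (punchIn j₀ j) * 1/ d j₀)
                                        ≡⟨ cong -_ (Σ-*ʳ (1/ d j₀) (λ j → α j * d (punchIn j₀ j))) ⟩
        - (T * 1/ d j₀)                 ≡⟨ solve-pivot (γ j₀) (d j₀) (1/ d j₀) T orthogonal ⟩
        γ j₀ * (d j₀ * 1/ d j₀)         ≡⟨ cong (γ j₀ *_) (ℚP.*-inverseʳ (d j₀)) ⟩
        γ j₀ * 1ℚ                       ≡⟨ ℚP.*-identityʳ (γ j₀) ⟩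
        γ j₀                            ∎
        where
        open ≡-Reasoning
        solve-pivot : ∀ g e e⁻¹ T → g * e + T ≡ 0ℚ → - (T * e⁻¹) ≡ g * (e * e⁻¹)
        solve-pivot g e e⁻¹ T g*e+T≡0 = begin
          - (T * e⁻¹)                  ≡⟨ cong (λ z → - (z * e⁻¹)) (isolate g e T) ⟩
          - (((g * e + T) - g * e) * e⁻¹) ≡⟨ cong (λ z → - ((z - g * e) * e⁻¹)) g*e+T≡0 ⟩
          - ((0ℚ - g * e) * e⁻¹)       ≡⟨ cancel g e e⁻¹ ⟩
          g * (e * e⁻¹)                ∎
          where
          isolate : ∀ g e T → T ≡ (g * e + T) - g * e
          isolate = solve-∀ ℚ-ring
          cancel : ∀ g e e⁻¹ → - ((0ℚ - g * e) * e⁻¹) ≡ g * (e * e⁻¹)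
          cancel = solve-∀ ℚ-ring
      coefficients : ∀ l → γ l ≡ insertAt α j₀ (- Σ[<] k (λ j → α j * t j)) l
      coefficients l = trans (sym (insertAt-removeAt γ j₀ l))
                             (cong (λ c → insertAt α j₀ c l) (sym pivot-coefficient))
      x-expansion : ∀ i → x i ≡ combination α vec′ i
      x-expansion i = begin
        x i                                                       ≡⟨ proj₂ (span x (x∈ker ∘ suc)) i ⟩
        combination γ vec i                                       ≡⟨ Σ-cong (λ l → cong (_* vec l i) (coefficients l)) ⟩
        combination (insertAt α j₀ (- Σ[<] k (λ j → α j * t j))) vec i ≡⟨ combination-eliminate vec j₀ t α i ⟩
        combination α vec′ i                                      ∎
        where open ≡-Reasoning

    basis : Basis R k
    basis = record { vec = vec′ ; mem = mem′ ; indep = eliminate-indep vec j₀ t indep ; span = span′ }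

  kernel-basis : ∀ {n} r (R : Fin r → Fin n → ℚ) → Σ ℕ (Basis R)
  kernel-basis zero    R = _ , standard-basis R
  kernel-basis (suc r) R with kernel-basis r (R ∘ suc)
  ... | k , b with zero-or-nonzero (λ l → dot (R zero) (Basis.vec b l))
  ...   | inj₁ orthogonal = k , record
          { vec   = vec
          ; mem   = λ { l zero → orthogonal l ; l (suc i) → mem l i }
          ; indep = indep
          ; span  = λ x x∈ker → span x (x∈ker ∘ suc)
          }
    where open Basis b
  kernel-basis (suc r) R | suc k , b | inj₂ (j₀ , pivot≢0) =
    k , AddPivotRow.basis R b j₀ pivot≢0

  -- Any independent family in the kernel is no larger than a basis: its
  -- coordinate vectors with respect to the basis are independent in ℚᵏ.
  basis-is-maximal : ∀ {n r k} {R : Fin r → Fin n → ℚ} → Basis R k →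
    ∀ m (xs : Fin m → Fin n → ℚ) → (∀ l → Ker R (xs l)) → LinIndep xs → m ℕ.≤ k
  basis-is-maximal {n} {r} {k} b m xs xs∈ker xs-indep = steinitz k m C C-indep
    where
    open Basis b
    C : Fin m → Fin k → ℚ
    C j = proj₁ (span (xs j) (xs∈ker j))
    C-indep : LinIndep C
    C-indep α vanishes = xs-indep α λ i → begin
      Σ[<] m (λ j → α j * xs j i)
        ≡⟨ Σ-cong (λ j → cong (α j *_) (proj₂ (span (xs j) (xs∈ker j)) i)) ⟩
      Σ[<] m (λ j → α j * Σ[<] k (λ l → C j l * vec l i))
        ≡⟨ Σ-cong (λ j → sym (Σ-*ˡ (α j) (λ l → C j l * vec l i))) ⟩
      Σ[<] m (λ j → Σ[<] k (λ l → α j * (C j l * vec l i)))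
        ≡⟨ Σ-swap (λ j l → α j * (C j l * vec l i)) ⟩
      Σ[<] k (λ l → Σ[<] m (λ j → α j * (C j l * vec l i)))
        ≡⟨ Σ-cong (λ l → trans (Σ-cong (λ j → sym (ℚP.*-assoc (α j) (C j l) (vec l i))))
                               (Σ-*ʳ (vec l i) (λ j → α j * C j l))) ⟩
      Σ[<] k (λ l → Σ[<] m (λ j → α j * C j l) * vec l i)
        ≡⟨ Σ-zero (λ l → trans (cong (_* vec l i) (vanishes l)) (ℚP.*-zeroˡ (vec l i))) ⟩
      0ℚ ∎
      where open ≡-Reasoning

  nullity-exists : ∀ {n} (G : Graph n) → Σ ℕ (HasNullity G)
  nullity-exists {n} G with kernel-basis n (A G)
  ... | k , b = k , (vec , mem , indep) , basis-is-maximal b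
    where open Basis b

open LinearAlgebra

module KernelCorrespondence where

  record KernelIso {n m} (G : Graph n) (H : Graph m) : Set where
    field
      to          : (Fin n → ℚ) → Fin m → ℚ
      from        : (Fin m → ℚ) → Fin n → ℚ
      to-cong     : ∀ {x y} → (∀ w → x w ≡ y w) → ∀ a → to x a ≡ to y a
      from-cong   : ∀ {z z′} → (∀ a → z a ≡ z′ a) → ∀ w → from z w ≡ from z′ w
      to-linear   : ∀ {k} c (xs : Fin k → Fin n → ℚ) a →
                    to (combination c xs) a ≡ combination c (to ∘ xs) a
      from-linear : ∀ {k} c (zs : Fin k → Fin m → ℚ) w →
                    from (combination c zs) w ≡ combination c (from ∘ zs) w
      to-ker      : ∀ x → InKer G x → InKer H (to x)
      from-ker    : ∀ z → InKer H z → InKer G (from z)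
      from-to     : ∀ x → InKer G x → ∀ w → from (to x) w ≡ x w
      to-from     : ∀ z → InKer H z → ∀ a → to (from z) a ≡ z a

  reverse : ∀ {n m} {G : Graph n} {H : Graph m} → KernelIso G H → KernelIso H G
  reverse iso = record
    { to = from ; from = to ; to-cong = from-cong ; from-cong = to-cong
    ; to-linear = from-linear ; from-linear = to-linear
    ; to-ker = from-ker ; from-ker = to-ker ; from-to = to-from ; to-from = from-to }
    where open KernelIso iso

  module _ {n m} {G : Graph n} {H : Graph m} (iso : KernelIso G H) where
    open KernelIso iso

    -- A linear map sends the zero vector (the empty combination) to zero.
    from-zero : ∀ w → from (λ _ → 0ℚ) w ≡ 0ℚ
    from-zero = from-linear {k = 0} (λ ()) (λ ())

    to-indep : ∀ {k} (xs : Fin k → Fin n → ℚ) → (∀ l → InKer G (xs l)) →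
      LinIndep xs → LinIndep (to ∘ xs)
    to-indep {k} xs xs∈ker xs-indep c vanishes = xs-indep c λ w → begin
      Σ[<] k (λ l → c l * xs l w)              ≡⟨ Σ-cong (λ l → cong (c l *_) (sym (from-to (xs l) (xs∈ker l) w))) ⟩
      combination c (from ∘ to ∘ xs) w          ≡⟨ sym (from-linear c (to ∘ xs) w) ⟩
      from (combination c (to ∘ xs)) w          ≡⟨ from-cong vanishes w ⟩
      from (λ _ → 0ℚ) w                         ≡⟨ from-zero w ⟩
      0ℚ                                        ∎
      where open ≡-Reasoning

  module _ {n m} {G : Graph n} {H : Graph m} (iso : KernelIso G H) where
    open KernelIso iso

    transfer-nullity : ∀ k → HasNullity G k → HasNullity H k
    transfer-nullity k ((xs , xs∈ker , xs-indep) , maximal) =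
      (to ∘ xs , (λ l → to-ker (xs l) (xs∈ker l)) , to-indep iso xs xs∈ker xs-indep) ,
      λ j zs zs∈ker zs-indep →
        maximal j (from ∘ zs) (λ l → from-ker (zs l) (zs∈ker l))
                (to-indep (reverse iso) zs zs∈ker zs-indep)

    transfer-singular : Singular G → Singular H
    transfer-singular (x , x∈ker , w , xw≢0) with zero-or-nonzero (to x)
    ... | inj₂ (a , nonzero) = to x , to-ker x x∈ker , a , nonzero
    ... | inj₁ to-x≡0 = ⊥-elim (xw≢0 (begin
      x w                  ≡⟨ sym (from-to x x∈ker w) ⟩
      from (to x) w        ≡⟨ from-cong to-x≡0 w ⟩
      from (λ _ → 0ℚ) w    ≡⟨ from-zero iso w ⟩
      0ℚ                   ∎))
      where open ≡-Reasoning

    Governs : Fin n → ℚ → Fin m → Set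
    Governs w s a = ∀ x → to x a ≡ s * x w

    core-forward : ∀ {w s a} → Governs w s a → s ≢ 0ℚ → CoreVertex G w → CoreVertex H a
    core-forward {w} {s} {a} governs s≢0 (x , x∈ker , xw≢0) =
      to x , to-ker x x∈ker , λ to-x-a≡0 → *-≢0 s (x w) s≢0 xw≢0 (trans (sym (governs x)) to-x-a≡0)

    core-backward : ∀ {w s a} → Governs w s a → CoreVertex H a → CoreVertex G w
    core-backward {w} {s} {a} governs (z , z∈ker , za≢0) =
      from z , from-ker z z∈ker , λ from-z-w≡0 → za≢0 (begin
        z a                  ≡⟨ sym (to-from z z∈ker a) ⟩
        to (from z) a        ≡⟨ governs (from z) ⟩
        s * from z w         ≡⟨ cong (s *_) from-z-w≡0 ⟩
        s * 0ℚ               ≡⟨ ℚP.*-zeroʳ s ⟩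
        0ℚ                   ∎)
      where open ≡-Reasoning

open KernelCorrespondence

A≡δ : ∀ {m} (H : Graph m) i j → A H i j ≡ δ (adj H i j)
A≡δ H i j with adj H i j
... | true  = refl
... | false = refl

module ListSums where

  Σ-list : ∀ {n} → List (Fin n) → (Fin n → ℚ) → ℚ
  Σ-list []      f = 0ℚ
  Σ-list (x ∷ l) f = f x + Σ-list l f

  Σ-lookup : ∀ {n} (l : List (Fin n)) (f : Fin n → ℚ) →
    Σ[<] (length l) (f ∘ lookup l) ≡ Σ-list l f
  Σ-lookup []      f = refl
  Σ-lookup (x ∷ l) f = cong (f x +_) (Σ-lookup l f)

  Σ-filter : ∀ {n} (p : Fin n → Bool) (l : List (Fin n)) (f : Fin n → ℚ) →
    Σ-list (filterᵇ p l) f ≡ Σ-list l (λ x → δ (p x) * f x)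
  Σ-filter p []      f = refl
  Σ-filter p (x ∷ l) f with p x
  ... | true  = cong₂ _+_ (sym (ℚP.*-identityˡ (f x))) (Σ-filter p l f)
  ... | false = trans (Σ-filter p l f)
                      (sym (trans (cong (_+ _) (ℚP.*-zeroˡ (f x))) (ℚP.+-identityˡ _)))

  Σ-tabulate : ∀ {n m} (g : Fin m → Fin n) (f : Fin n → ℚ) →
    Σ-list (tabulate g) f ≡ Σ[<] m (f ∘ g)
  Σ-tabulate {m = zero}  g f = refl
  Σ-tabulate {m = suc m} g f = cong (f (g zero) +_) (Σ-tabulate (g ∘ suc) f)

  filter-satisfies : ∀ {n} (p : Fin n → Bool) (l : List (Fin n)) i →
    p (lookup (filterᵇ p l) i) ≡ true
  filter-satisfies p []      ()
  filter-satisfies p (x ∷ l) i with p x in px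
  filter-satisfies p (x ∷ l) zero    | true  = px
  filter-satisfies p (x ∷ l) (suc i) | true  = filter-satisfies p l i
  filter-satisfies p (x ∷ l) i       | false = filter-satisfies p l i

open ListSums

module Neighbourhood {n} (G : Graph n) (v : Fin n) where
  ρ : ℕ
  ρ = deg G v
  u : Fin ρ → Fin n
  u = nbr G v

  u-adjacent : ∀ i → adj G v (u i) ≡ true
  u-adjacent = filter-satisfies (adj G v) (allFin n)

  u≢v : ∀ i → u i ≢ v
  u≢v i uᵢ≡v with trans (sym (u-adjacent i)) (trans (cong (adj G v) uᵢ≡v) (adj-irrefl G v))
  ... | ()

  Σ-neighbours : ∀ (f : Fin n → ℚ) → Σ[<] ρ (f ∘ u) ≡ Σ[<] n (λ j → δ (adj G v j) * f j)
  Σ-neighbours f = begin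
    Σ[<] ρ (f ∘ u)                                  ≡⟨ Σ-lookup (nbrs G v) f ⟩
    Σ-list (nbrs G v) f                             ≡⟨ Σ-filter (adj G v) (allFin n) f ⟩
    Σ-list (allFin n) (λ j → δ (adj G v j) * f j)   ≡⟨ Σ-tabulate {n} {n} (λ j → j) (λ j → δ (adj G v j) * f j) ⟩
    Σ[<] n (λ j → δ (adj G v j) * f j)              ∎
    where open ≡-Reasoning

  Σ-neighbours-δ : ∀ w c → Σ[<] ρ (λ i → δ (w == u i) * c) ≡ δ (adj G v w) * c
  Σ-neighbours-δ w c = begin
    Σ[<] ρ (λ i → δ (w == u i) * c)                  ≡⟨ Σ-neighbours (λ j → δ (w == j) * c) ⟩
    Σ[<] n (λ j → δ (adj G v j) * (δ (w == j) * c))  ≡⟨ Σ-cong (λ j → swap (δ (adj G v j)) (δ (w == j)) c) ⟩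
    Σ[<] n (λ j → δ (w == j) * (δ (adj G v j) * c))  ≡⟨ Σ-δ' w (λ j → δ (adj G v j) * c) ⟩
    δ (adj G v w) * c                                ∎
    where
    open ≡-Reasoning
    swap : ∀ a b c → a * (b * c) ≡ b * (a * c)
    swap = solve-∀ ℚ-ring

  A-row-v : ∀ y → Σ[<] n (λ j → A G v j * y j) ≡ Σ[<] ρ (y ∘ u)
  A-row-v y = trans (Σ-cong (λ j → cong (_* y j) (A≡δ G v j))) (sym (Σ-neighbours y))

pattern old w = inj₁ w
pattern p i = inj₂ (inj₁ i)
pattern q i = inj₂ (inj₂ i)

module FowlerRows {n} (G : Graph n) (v : Fin n) where
  open Neighbourhood G v public

  N : ℕ
  N = n ℕ.+ (ρ ℕ.+ ρ)
  F : Graph N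
  F = Fowler G v

  index : FV G v → Fin N
  index (old w) = w ↑ˡ (ρ ℕ.+ ρ)
  index (p i)   = n ↑ʳ (i ↑ˡ ρ)
  index (q i)   = n ↑ʳ (ρ ↑ʳ i)

  split-index : ∀ t → split G v (index t) ≡ t
  split-index (old w) rewrite FinP.splitAt-↑ˡ n w (ρ ℕ.+ ρ) = refl
  split-index (p i) rewrite FinP.splitAt-↑ʳ n (ρ ℕ.+ ρ) (i ↑ˡ ρ) | FinP.splitAt-↑ˡ ρ i ρ = refl
  split-index (q i) rewrite FinP.splitAt-↑ʳ n (ρ ℕ.+ ρ) (ρ ↑ʳ i) | FinP.splitAt-↑ʳ ρ ρ i = refl

  index-split : ∀ a → index (split G v a) ≡ a
  index-split a with splitAt n a in eq
  ... | inj₁ w = trans (cong (join n (ρ ℕ.+ ρ)) (sym eq)) (FinP.join-splitAt n (ρ ℕ.+ ρ) a)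
  ... | inj₂ b = begin
    index (inj₂ (splitAt ρ b))           ≡⟨ index-new (splitAt ρ b) ⟩
    n ↑ʳ join ρ ρ (splitAt ρ b)          ≡⟨ cong (n ↑ʳ_) (FinP.join-splitAt ρ ρ b) ⟩
    join n (ρ ℕ.+ ρ) (inj₂ b)            ≡⟨ cong (join n (ρ ℕ.+ ρ)) (sym eq) ⟩
    join n (ρ ℕ.+ ρ) (splitAt n a)       ≡⟨ FinP.join-splitAt n (ρ ℕ.+ ρ) a ⟩
    a                                    ∎
    where
    open ≡-Reasoning
    index-new : ∀ s → index (inj₂ s) ≡ n ↑ʳ join ρ ρ s
    index-new (inj₁ i) = refl
    index-new (inj₂ i) = refl

  Σ-FV : (FV G v → ℚ) → ℚ
  Σ-FV h = Σ[<] n (h ∘ old) + (Σ[<] ρ (h ∘ p) + Σ[<] ρ (h ∘ q))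

  Σ-FV-cong : ∀ {h h′ : FV G v → ℚ} → (∀ t → h t ≡ h′ t) → Σ-FV h ≡ Σ-FV h′
  Σ-FV-cong h≗h′ = cong₂ _+_ (Σ-cong (h≗h′ ∘ old))
                             (cong₂ _+_ (Σ-cong (h≗h′ ∘ p)) (Σ-cong (h≗h′ ∘ q)))

  Σ-N : ∀ g → Σ[<] N g ≡ Σ-FV (g ∘ index)
  Σ-N g = trans (Σ-++ n (ρ ℕ.+ ρ) g) (cong (Σ[<] n (g ∘ index ∘ old) +_) (Σ-++ ρ ρ (λ j → g (n ↑ʳ j))))

  row : FV G v → (FV G v → ℚ) → ℚ
  row s Z = Σ-FV (λ t → δ (fadj G v s t) * Z t)

  row-cong : ∀ s {Z Z′ : FV G v → ℚ} → (∀ t → Z t ≡ Z′ t) → row s Z ≡ row s Z′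
  row-cong s Z≗Z′ = Σ-FV-cong (λ t → cong (δ (fadj G v s t) *_) (Z≗Z′ t))

  row-index : ∀ (z : Fin N → ℚ) a → Σ[<] N (λ b → A F a b * z b) ≡ row (split G v a) (z ∘ index)
  row-index z a = trans (Σ-N (λ b → A F a b * z b)) (Σ-FV-cong λ t → cong (_* z (index t))
    (trans (A≡δ F a (index t)) (cong (λ t′ → δ (fadj G v (split G v a) t′)) (split-index t))))

  kernel-rows : ∀ z → InKer F z → ∀ s → row s (z ∘ index) ≡ 0ℚ
  kernel-rows z z∈ker s = begin
    row s (z ∘ index)                      ≡⟨ cong (λ t → row t (z ∘ index)) (sym (split-index s)) ⟩
    row (split G v (index s)) (z ∘ index)  ≡⟨ sym (row-index z (index s)) ⟩
    Σ[<] N (λ b → A F (index s) b * z b)   ≡⟨ z∈ker (index s) ⟩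
    0ℚ                                     ∎
    where open ≡-Reasoning

  rows-kernel : ∀ z → (∀ s → row s (z ∘ index) ≡ 0ℚ) → InKer F z
  rows-kernel z rows≡0 a = trans (row-index z a) (rows≡0 (split G v a))

  restricted : Fin n → (Fin n → ℚ) → ℚ
  restricted w Y = Σ[<] n (λ j → δ (adj G w j ∧ not (j == v)) * Y j)

  restricted-cong : ∀ w {Y Y′ : Fin n → ℚ} → (∀ j → j ≢ v → Y j ≡ Y′ j) →
    restricted w Y ≡ restricted w Y′
  restricted-cong w {Y} {Y′} Y≗Y′ = Σ-cong (λ j → entry j (j FinP.≟ v))
    where
    entry : ∀ j → Dec (j ≡ v) → δ (adj G w j ∧ not (j == v)) * Y j ≡ δ (adj G w j ∧ not (j == v)) * Y′ j
    entry j (no j≢v)  = cong (δ (adj G w j ∧ not (j == v)) *_) (Y≗Y′ j j≢v)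
    entry v (yes refl) = trans (weight-zero v-column (Y v)) (sym (weight-zero v-column (Y′ v)))
      where
      v-column : adj G w v ∧ not (v == v) ≡ false
      v-column rewrite ==-refl v = ∧-zeroʳ (adj G w v)

  G-row-split : ∀ w Y → Σ[<] n (λ j → A G w j * Y j) ≡ restricted w Y + δ (adj G w v) * Y v
  G-row-split w Y = begin
    Σ[<] n (λ j → A G w j * Y j)
      ≡⟨ Σ-cong (λ j → trans (cong (_* Y j) (A≡δ G w j)) (split-weight (adj G w j) (j == v) (Y j))) ⟩
    Σ[<] n (λ j → δ (adj G w j ∧ not (j == v)) * Y j + δ (j == v) * (δ (adj G w j) * Y j))
      ≡⟨ Σ-+ _ (λ j → δ (j == v) * (δ (adj G w j) * Y j)) ⟩
    restricted w Y + Σ[<] n (λ j → δ (j == v) * (δ (adj G w j) * Y j))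
      ≡⟨ cong (restricted w Y +_) (Σ-δ v (λ j → δ (adj G w j) * Y j)) ⟩
    restricted w Y + δ (adj G w v) * Y v ∎
    where
    open ≡-Reasoning
    split-weight : ∀ b e y → δ b * y ≡ δ (b ∧ not e) * y + δ e * (δ b * y)
    split-weight true  true  = solve-∀ ℚ-ring
    split-weight true  false = solve-∀ ℚ-ring
    split-weight false true  = solve-∀ ℚ-ring
    split-weight false false = solve-∀ ℚ-ring

  row-v : ∀ Z → row (old v) Z ≡ Σ[<] ρ (Z ∘ q)
  row-v Z = begin
    row (old v) Z
      ≡⟨ cong₂ _+_ (Σ-zero (λ j → weight-zero (no-old-edge j) (Z (old j))))
                   (cong₂ _+_ (Σ-zero (λ i → weight-zero (==-false (u≢v i ∘ sym)) (Z (p i))))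
                              (Σ-cong (λ i → weight-one (==-refl v) (Z (q i))))) ⟩
    0ℚ + (0ℚ + Σ[<] ρ (Z ∘ q))
      ≡⟨ trans (ℚP.+-identityˡ _) (ℚP.+-identityˡ (Σ[<] ρ (Z ∘ q))) ⟩
    Σ[<] ρ (Z ∘ q) ∎
    where
    open ≡-Reasoning
    no-old-edge : ∀ j → fadj G v (old v) (old j) ≡ false
    no-old-edge j rewrite ==-refl v = ∧-zeroʳ (adj G v j)

  row-p : ∀ Z i → row (p i) Z ≡ Z (old (u i)) + (Σ[<] ρ (Z ∘ q) - Z (q i))
  row-p Z i = begin
    row (p i) Z
      ≡⟨ cong₂ _+_ (Σ-δ (u i) (Z ∘ old))
                   (cong₂ _+_ (Σ-zero (λ k → ℚP.*-zeroˡ (Z (p k))))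
                              (trans (Σ-cong (λ k → cong (λ b → δ (not b) * Z (q k)) (==-sym i k)))
                                     (Σ-all-but i (Z ∘ q)))) ⟩
    Z (old (u i)) + (0ℚ + (Σ[<] ρ (Z ∘ q) - Z (q i)))
      ≡⟨ cong (Z (old (u i)) +_) (ℚP.+-identityˡ _) ⟩
    Z (old (u i)) + (Σ[<] ρ (Z ∘ q) - Z (q i)) ∎
    where open ≡-Reasoning

  row-q : ∀ Z k → row (q k) Z ≡ Z (old v) + (Σ[<] ρ (Z ∘ p) - Z (p k))
  row-q Z k = begin
    row (q k) Z
      ≡⟨ cong₂ _+_ (Σ-δ v (Z ∘ old))
                   (cong₂ _+_ (Σ-all-but k (Z ∘ p)) (Σ-zero (λ i → ℚP.*-zeroˡ (Z (q i))))) ⟩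
    Z (old v) + ((Σ[<] ρ (Z ∘ p) - Z (p k)) + 0ℚ)
      ≡⟨ cong (Z (old v) +_) (ℚP.+-identityʳ _) ⟩
    Z (old v) + (Σ[<] ρ (Z ∘ p) - Z (p k)) ∎
    where open ≡-Reasoning

  row-w : ∀ Z w c → w ≢ v → (∀ i → Z (p i) ≡ c) →
    row (old w) Z ≡ restricted w (Z ∘ old) + δ (adj G w v) * c
  row-w Z w c w≢v p-constant = begin
    row (old w) Z
      ≡⟨ cong₂ _+_ (Σ-cong (λ j → cong (λ b → δ (adj G w j ∧ not b ∧ not (j == v)) * Z (old j)) (==-false w≢v)))
                   (cong₂ _+_ (Σ-cong (λ i → cong (δ (w == u i) *_) (p-constant i)))
                              (Σ-zero (λ i → weight-zero (==-false w≢v) (Z (q i))))) ⟩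
    restricted w (Z ∘ old) + (Σ[<] ρ (λ i → δ (w == u i) * c) + 0ℚ)
      ≡⟨ cong (restricted w (Z ∘ old) +_) (trans (ℚP.+-identityʳ _) (Σ-neighbours-δ w c)) ⟩
    restricted w (Z ∘ old) + δ (adj G v w) * c
      ≡⟨ cong (λ b → restricted w (Z ∘ old) + δ b * c) (adj-sym G v w) ⟩
    restricted w (Z ∘ old) + δ (adj G w v) * c ∎
    where open ≡-Reasoning

module FowlerKernel {n} (G : Graph n) (v : Fin n) where
  open FowlerRows G v public

  old-weight : Bool → ℚ
  old-weight true  = 1ℚ - fromℕ ρ
  old-weight false = 1ℚ

  expand′ : (Fin n → ℚ) → FV G v → ℚ
  expand′ y (old w) = old-weight (w == v) * y w
  expand′ y (p i)   = y v
  expand′ y (q i)   = y (u i)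

  expand : (Fin n → ℚ) → Fin N → ℚ
  expand y = expand′ y ∘ split G v

  contract : (Fin N → ℚ) → Fin n → ℚ
  contract z w = z (index (old w)) + δ (w == v) * Σ[<] ρ (λ i → z (index (p i)))

  expand-index : ∀ y t → expand y (index t) ≡ expand′ y t
  expand-index y t = cong (expand′ y) (split-index t)

  module KernelOfG (y : Fin n → ℚ) (y∈ker : InKer G y) where
    neighbour-sum : Σ[<] ρ (y ∘ u) ≡ 0ℚ
    neighbour-sum = trans (sym (A-row-v y)) (y∈ker v)

    old-row : ∀ w → Dec (w ≡ v) → row (old w) (expand′ y) ≡ 0ℚ
    old-row v (yes refl) = trans (row-v (expand′ y)) neighbour-sum
    old-row w (no w≢v) = begin
      row (old w) (expand′ y)                         ≡⟨ row-w (expand′ y) w (y v) w≢v (λ _ → refl) ⟩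
      restricted w (expand′ y ∘ old) + δ (adj G w v) * y v
        ≡⟨ cong (_+ δ (adj G w v) * y v) (restricted-cong w off-v) ⟩
      restricted w y + δ (adj G w v) * y v            ≡⟨ sym (G-row-split w y) ⟩
      Σ[<] n (λ j → A G w j * y j)                    ≡⟨ y∈ker w ⟩
      0ℚ                                              ∎
      where
      open ≡-Reasoning
      off-v : ∀ j → j ≢ v → old-weight (j == v) * y j ≡ y j
      off-v j j≢v = trans (cong (λ b → old-weight b * y j) (==-false j≢v)) (ℚP.*-identityˡ (y j))

    p-row : ∀ i → row (p i) (expand′ y) ≡ 0ℚ
    p-row i = begin
      row (p i) (expand′ y)                                   ≡⟨ row-p (expand′ y) i ⟩
      old-weight (u i == v) * y (u i) + (Σ[<] ρ (y ∘ u) - y (u i))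
        ≡⟨ cong₂ (λ b S → old-weight b * y (u i) + (S - y (u i))) (==-false (u≢v i)) neighbour-sum ⟩
      1ℚ * y (u i) + (0ℚ - y (u i))                           ≡⟨ cancel (y (u i)) ⟩
      0ℚ                                                      ∎
      where
      open ≡-Reasoning
      cancel : ∀ a → 1ℚ * a + (0ℚ - a) ≡ 0ℚ
      cancel = solve-∀ ℚ-ring

    q-row : ∀ k → row (q k) (expand′ y) ≡ 0ℚ
    q-row k = begin
      row (q k) (expand′ y)                                   ≡⟨ row-q (expand′ y) k ⟩
      old-weight (v == v) * y v + (Σ[<] ρ (λ _ → y v) - y v)
        ≡⟨ cong₂ (λ b S → old-weight b * y v + (S - y v)) (==-refl v) (Σ-const ρ (y v)) ⟩
      (1ℚ - fromℕ ρ) * y v + (fromℕ ρ * y v - y v)           ≡⟨ cancel (fromℕ ρ) (y v) ⟩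
      0ℚ                                                      ∎
      where
      open ≡-Reasoning
      cancel : ∀ r a → (1ℚ - r) * a + (r * a - a) ≡ 0ℚ
      cancel = solve-∀ ℚ-ring

    expand-kernel : InKer F (expand y)
    expand-kernel = rows-kernel (expand y) λ s → trans (row-cong s (expand-index y)) (rows s)
      where
      rows : ∀ s → row s (expand′ y) ≡ 0ℚ
      rows (old w) = old-row w (w FinP.≟ v)
      rows (p i)   = p-row i
      rows (q k)   = q-row k

  module KernelOfF (z : Fin N → ℚ) (z∈ker : InKer F z) where
    Z : FV G v → ℚ
    Z = z ∘ index

    -- the common value of the pᵢ-entries
    c : ℚ
    c = Z (old v) + Σ[<] ρ (Z ∘ p)

    q-sum : Σ[<] ρ (Z ∘ q) ≡ 0ℚ
    q-sum = trans (sym (row-v Z)) (kernel-rows z z∈ker (old v))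

    u-matches-q : ∀ i → Z (old (u i)) ≡ Z (q i)
    u-matches-q i = solve-for (Z (old (u i))) (Z (q i)) (begin
      Z (old (u i)) + (0ℚ - Z (q i))                ≡⟨ cong (λ S → Z (old (u i)) + (S - Z (q i))) (sym q-sum) ⟩
      Z (old (u i)) + (Σ[<] ρ (Z ∘ q) - Z (q i))    ≡⟨ sym (row-p Z i) ⟩
      row (p i) Z                                   ≡⟨ kernel-rows z z∈ker (p i) ⟩
      0ℚ                                            ∎)
      where
      open ≡-Reasoning
      solve-for : ∀ a b → a + (0ℚ - b) ≡ 0ℚ → a ≡ b
      solve-for a b a-b≡0 = begin
        a                           ≡⟨ add-back a b ⟩
        (a + (0ℚ - b)) + b          ≡⟨ cong (_+ b) a-b≡0 ⟩
        0ℚ + b                      ≡⟨ ℚP.+-identityˡ b ⟩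
        b                           ∎
        where
        add-back : ∀ a b → a ≡ (a + (0ℚ - b)) + b
        add-back = solve-∀ ℚ-ring

    p-constant : ∀ k → Z (p k) ≡ c
    p-constant k = solve-for (Z (old v)) (Σ[<] ρ (Z ∘ p)) (Z (p k))
                             (trans (sym (row-q Z k)) (kernel-rows z z∈ker (q k)))
      where
      open ≡-Reasoning
      solve-for : ∀ a S b → a + (S - b) ≡ 0ℚ → b ≡ a + S
      solve-for a S b a+S-b≡0 = begin
        b                           ≡⟨ add-back a S b ⟩
        (a + S) - (a + (S - b))     ≡⟨ cong (λ x → (a + S) - x) a+S-b≡0 ⟩
        (a + S) - 0ℚ                ≡⟨ minus-zero (a + S) ⟩
        a + S                       ∎
        where
        add-back : ∀ a S b → b ≡ (a + S) - (a + (S - b))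
        add-back = solve-∀ ℚ-ring
        minus-zero : ∀ x → x - 0ℚ ≡ x
        minus-zero = solve-∀ ℚ-ring

    contract-v : contract z v ≡ c
    contract-v = trans (cong (λ b → Z (old v) + δ b * Σ[<] ρ (Z ∘ p)) (==-refl v))
                       (cong (Z (old v) +_) (ℚP.*-identityˡ _))

    contract-off-v : ∀ w → w ≢ v → contract z w ≡ Z (old w)
    contract-off-v w w≢v = trans (cong (Z (old w) +_) (weight-zero (==-false w≢v) _))
                                 (ℚP.+-identityʳ (Z (old w)))

    contract-u : ∀ i → contract z (u i) ≡ Z (q i)
    contract-u i = trans (contract-off-v (u i) (u≢v i)) (u-matches-q i)

    contract-kernel : InKer G (contract z)
    contract-kernel w = row-at w (w FinP.≟ v)
      where
      row-at : ∀ w → Dec (w ≡ v) → Σ[<] n (λ j → A G w j * contract z j) ≡ 0ℚ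
      row-at v (yes refl) = trans (A-row-v (contract z)) (trans (Σ-cong contract-u) q-sum)
      row-at w (no w≢v) = begin
        Σ[<] n (λ j → A G w j * contract z j)                      ≡⟨ G-row-split w (contract z) ⟩
        restricted w (contract z) + δ (adj G w v) * contract z v
          ≡⟨ cong₂ (λ R x → R + δ (adj G w v) * x) (restricted-cong w contract-off-v) contract-v ⟩
        restricted w (Z ∘ old) + δ (adj G w v) * c                 ≡⟨ sym (row-w Z w c w≢v p-constant) ⟩
        row (old w) Z                                              ≡⟨ kernel-rows z z∈ker (old w) ⟩
        0ℚ                                                         ∎
        where open ≡-Reasoning

    -- expand undoes contract on the kernel: (1 - ρ)·c = z(v) since Σᵢ z(pᵢ) = ρ·c
    expand-contract : ∀ a → expand (contract z) a ≡ z a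
    expand-contract a = trans (on-vertex (split G v a)) (cong z (index-split a))
      where
      old-entry : ∀ w → Dec (w ≡ v) → expand′ (contract z) (old w) ≡ Z (old w)
      old-entry v (yes refl) = begin
        old-weight (v == v) * contract z v              ≡⟨ cong₂ (λ b x → old-weight b * x) (==-refl v) contract-v ⟩
        (1ℚ - fromℕ ρ) * c                              ≡⟨ recover (fromℕ ρ) (Z (old v)) (Σ[<] ρ (Z ∘ p)) p-sum ⟩
        Z (old v)                                       ∎
        where
        open ≡-Reasoning
        p-sum : Σ[<] ρ (Z ∘ p) ≡ fromℕ ρ * c
        p-sum = trans (Σ-cong p-constant) (Σ-const ρ c)
        recover : ∀ r a S → S ≡ r * (a + S) → (1ℚ - r) * (a + S) ≡ a
        recover r a S S≡r[a+S] = begin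
          (1ℚ - r) * (a + S)         ≡⟨ expand-product r (a + S) ⟩
          (a + S) - r * (a + S)      ≡⟨ cong (λ x → (a + S) - x) (sym S≡r[a+S]) ⟩
          (a + S) - S                ≡⟨ cancel a S ⟩
          a                          ∎
          where
          expand-product : ∀ r x → (1ℚ - r) * x ≡ x - r * x
          expand-product = solve-∀ ℚ-ring
          cancel : ∀ a S → (a + S) - S ≡ a
          cancel = solve-∀ ℚ-ring
      old-entry w (no w≢v) =
        trans (cong₂ (λ b x → old-weight b * x) (==-false w≢v) (contract-off-v w w≢v))
              (ℚP.*-identityˡ (Z (old w)))
      on-vertex : ∀ t → expand′ (contract z) t ≡ Z t
      on-vertex (old w) = old-entry w (w FinP.≟ v)
      on-vertex (p i)   = trans contract-v (sym (p-constant i))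
      on-vertex (q i)   = contract-u i

  contract-expand : ∀ y w → contract (expand y) w ≡ y w
  contract-expand y w = on-vertex w (w FinP.≟ v)
    where
    p-sum : Σ[<] ρ (λ i → expand y (index (p i))) ≡ fromℕ ρ * y v
    p-sum = trans (Σ-cong (λ i → expand-index y (p i))) (Σ-const ρ (y v))
    on-vertex : ∀ w → Dec (w ≡ v) → contract (expand y) w ≡ y w
    on-vertex v (yes refl) = begin
      expand y (index (old v)) + δ (v == v) * Σ[<] ρ (λ i → expand y (index (p i)))
        ≡⟨ cong₂ (λ x S → x + δ (v == v) * S) (expand-index y (old v)) p-sum ⟩
      old-weight (v == v) * y v + δ (v == v) * (fromℕ ρ * y v)
        ≡⟨ cong (λ b → old-weight b * y v + δ b * (fromℕ ρ * y v)) (==-refl v) ⟩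
      (1ℚ - fromℕ ρ) * y v + 1ℚ * (fromℕ ρ * y v)
        ≡⟨ recombine (fromℕ ρ) (y v) ⟩
      y v ∎
      where
      open ≡-Reasoning
      recombine : ∀ r a → (1ℚ - r) * a + 1ℚ * (r * a) ≡ a
      recombine = solve-∀ ℚ-ring
    on-vertex w (no w≢v) = begin
      expand y (index (old w)) + δ (w == v) * Σ[<] ρ (λ i → expand y (index (p i)))
        ≡⟨ cong₂ _+_ (expand-index y (old w)) (weight-zero (==-false w≢v) _) ⟩
      old-weight (w == v) * y w + 0ℚ
        ≡⟨ cong (λ b → old-weight b * y w + 0ℚ) (==-false w≢v) ⟩
      1ℚ * y w + 0ℚ
        ≡⟨ trans (ℚP.+-identityʳ _) (ℚP.*-identityˡ (y w)) ⟩
      y w ∎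
      where open ≡-Reasoning

  expand-cong : ∀ {x y : Fin n → ℚ} → (∀ w → x w ≡ y w) → ∀ a → expand x a ≡ expand y a
  expand-cong x≗y a = on-vertex (split G v a)
    where
    on-vertex : ∀ t → expand′ _ t ≡ expand′ _ t
    on-vertex (old w) = cong (old-weight (w == v) *_) (x≗y w)
    on-vertex (p i)   = x≗y v
    on-vertex (q i)   = x≗y (u i)

  contract-cong : ∀ {z z′ : Fin N → ℚ} → (∀ a → z a ≡ z′ a) → ∀ w → contract z w ≡ contract z′ w
  contract-cong z≗z′ w = cong₂ _+_ (z≗z′ (index (old w)))
                                   (cong (δ (w == v) *_) (Σ-cong (λ i → z≗z′ (index (p i)))))

  expand-linear : ∀ {k} c (xs : Fin k → Fin n → ℚ) a →
    expand (combination c xs) a ≡ combination c (expand ∘ xs) a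
  expand-linear {k} c xs a = on-vertex (split G v a)
    where
    on-vertex : ∀ t → expand′ (combination c xs) t ≡ Σ[<] k (λ l → c l * expand′ (xs l) t)
    on-vertex (old w) = trans (sym (Σ-*ˡ (old-weight (w == v)) (λ l → c l * xs l w)))
                              (Σ-cong (λ l → swap (old-weight (w == v)) (c l) (xs l w)))
      where
      swap : ∀ s a x → s * (a * x) ≡ a * (s * x)
      swap = solve-∀ ℚ-ring
    on-vertex (p i) = refl
    on-vertex (q i) = refl

  contract-linear : ∀ {k} c (zs : Fin k → Fin N → ℚ) w →
    contract (combination c zs) w ≡ combination c (contract ∘ zs) w
  contract-linear {k} c zs w = sym (begin
    Σ[<] k (λ l → c l * (zs l (index (old w)) + e * S l))
      ≡⟨ Σ-cong (λ l → distribute (c l) (zs l (index (old w))) e (S l)) ⟩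
    Σ[<] k (λ l → c l * zs l (index (old w)) + e * (c l * S l))
      ≡⟨ Σ-+ (λ l → c l * zs l (index (old w))) (λ l → e * (c l * S l)) ⟩
    combination c zs (index (old w)) + Σ[<] k (λ l → e * (c l * S l))
      ≡⟨ cong (combination c zs (index (old w)) +_) (Σ-*ˡ e (λ l → c l * S l)) ⟩
    combination c zs (index (old w)) + e * Σ[<] k (λ l → c l * S l)
      ≡⟨ cong (λ x → combination c zs (index (old w)) + e * x) swap-sums ⟩
    combination c zs (index (old w)) + e * Σ[<] ρ (λ i → combination c zs (index (p i))) ∎)
    where
    open ≡-Reasoning
    e : ℚ
    e = δ (w == v)
    S : Fin k → ℚ
    S l = Σ[<] ρ (λ i → zs l (index (p i)))
    distribute : ∀ c a e s → c * (a + e * s) ≡ c * a + e * (c * s)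
    distribute = solve-∀ ℚ-ring
    swap-sums : Σ[<] k (λ l → c l * S l) ≡ Σ[<] ρ (λ i → combination c zs (index (p i)))
    swap-sums = trans (Σ-cong (λ l → sym (Σ-*ˡ (c l) (λ i → zs l (index (p i))))))
                      (Σ-swap (λ l i → c l * zs l (index (p i))))

  fowler-iso : KernelIso G F
  fowler-iso = record
    { to = expand ; from = contract ; to-cong = expand-cong ; from-cong = contract-cong
    ; to-linear = expand-linear ; from-linear = contract-linear
    ; to-ker = KernelOfG.expand-kernel ; from-ker = KernelOfF.contract-kernel
    ; from-to = λ y _ → contract-expand y ; to-from = KernelOfF.expand-contract }

module FowlerCore {n} (G : Graph n) (v : Fin n) where
  open FowlerKernel G v

  governs-old : ∀ w → Governs fowler-iso w (old-weight (w == v)) (index (old w))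
  governs-old w x = expand-index x (old w)

  governs-p : ∀ i → Governs fowler-iso v 1ℚ (index (p i))
  governs-p i x = trans (expand-index x (p i)) (sym (ℚP.*-identityˡ (x v)))

  governs-q : ∀ i → Governs fowler-iso (u i) 1ℚ (index (q i))
  governs-q i x = trans (expand-index x (q i)) (sym (ℚP.*-identityˡ (x (u i))))

  -- If v is a leaf, its neighbour is not a core vertex: row v of A(G)
  -- forces every kernel vector to vanish there.
  leaf-neighbour-not-core : (leaf : ρ ≡ 1) → ¬ CoreVertex G (u (subst Fin (sym leaf) zero))
  leaf-neighbour-not-core leaf (y , y∈ker , y≢0) =
    y≢0 (single-term leaf (y ∘ u) (trans (sym (A-row-v y)) (y∈ker v)))

  -- In a core graph v is not a leaf, so the weight 1 - ρ at v is nonzero.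
  core-at-v : (∀ w → CoreVertex G w) → CoreVertex F (index (old v))
  core-at-v core with ρ ℕ.≟ 1
  ... | yes leaf = ⊥-elim (leaf-neighbour-not-core leaf (core _))
  ... | no ρ≢1   =
    core-forward fowler-iso {s = old-weight (v == v)} (governs-old v) weight≢0 (core v)
    where
    weight≢0 : old-weight (v == v) ≢ 0ℚ
    weight≢0 rewrite ==-refl v = 1-fromℕ≢0 ρ ρ≢1

  core-forward-all : (∀ w → CoreVertex G w) → ∀ a → CoreVertex F a
  core-forward-all core a = subst (CoreVertex F) (index-split a) (at (split G v a))
    where
    old-vertex : ∀ w → Dec (w ≡ v) → CoreVertex F (index (old w))
    old-vertex v (yes refl) = core-at-v core
    old-vertex w (no w≢v)   =
      core-forward fowler-iso {s = old-weight (w == v)} (governs-old w) weight≢0 (core w)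
      where
      weight≢0 : old-weight (w == v) ≢ 0ℚ
      weight≢0 rewrite ==-false w≢v = ℚP.1≢0
    at : ∀ t → CoreVertex F (index t)
    at (old w) = old-vertex w (w FinP.≟ v)
    at (p i)   = core-forward fowler-iso (governs-p i) ℚP.1≢0 (core v)
    at (q i)   = core-forward fowler-iso (governs-q i) ℚP.1≢0 (core (u i))

  core-backward-all : (∀ a → CoreVertex F a) → ∀ w → CoreVertex G w
  core-backward-all core w =
    core-backward fowler-iso {s = old-weight (w == v)} (governs-old w) (core (index (old w)))

theorem3 : ∀ {n : ℕ} (G : Graph n) (v : Fin n) →
    (IsCoreGraph G ⇔ IsCoreGraph (Fowler G v))
    × Σ ℕ (λ k → HasNullity G k × HasNullity (Fowler G v) k)
theorem3 G v with nullity-exists G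
... | k , ηG = mk⇔ forward backward , (k , ηG , transfer-nullity fowler-iso k ηG)
  where
  open FowlerKernel G v using (fowler-iso)
  open FowlerCore G v using (core-forward-all; core-backward-all)
  forward : IsCoreGraph G → IsCoreGraph (Fowler G v)
  forward (singular , core) = transfer-singular fowler-iso singular , core-forward-all core
  backward : IsCoreGraph (Fowler G v) → IsCoreGraph G
  backward (singular , core) = transfer-singular (reverse fowler-iso) singular , core-backward-all core
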